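{- Let $k\ge 1$ and let $u=(u_k,\dots,u_2,u_1)$ be a vector of nonnegative integers that is spanning, meaning that for every integer $b$ with $0\le b\le uu^T=\sum_{i=1}^k u_i^2$ there exists a vector $v=(v_k,\dots,v_1)$ of nonnegative integers with $v\le u$ entrywise and $\sum_{i=1}^k v_iu_i=b$. Let $u_{k+1}$ be a nonnegative integer with $u_{k+1}\le uu^T+1$. Then the vector $(u_{k+1},u_k,\dots,u_2,u_1)$ is also spanning.
   Context: All numbers, vectors and matrices are nonnegative integers. For vectors $u,v$ of the same length, $vu^T=\sum_i v_iu_i$ and $v\le u$ means $v_i\le u_i$ for all $i$. -}

module Defs where

open import Data.Nat using (ℕ; zero; suc; _+_; _*_; _≤_)
open import Data.Vec using (Vec; []; _∷_; zipWith; foldr)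
open import Data.Vec.Relation.Binary.Pointwise.Inductive using (Pointwise)
open import Data.Product using (Σ; _×_)
open import Relation.Binary.PropositionalEquality using (_≡_)

dot : ∀ {n} → Vec ℕ n → Vec ℕ n → ℕ
dot v u = foldr (λ _ → ℕ) _+_ 0 (zipWith _*_ v u)

_≤ᵥ_ : ∀ {n} → Vec ℕ n → Vec ℕ n → Set
v ≤ᵥ u = Pointwise _≤_ v u

Spanning : ∀ {n} → Vec ℕ n → Set
Spanning {n} u = (b : ℕ) → b ≤ dot u u → Σ (Vec ℕ n) (λ v → v ≤ᵥ u × dot v u ≡ b)

-- For fixed d ≤ a the values d a + v uᵀ with v ≤ u fill the whole interval [d a, d a + uuᵀ],
-- since u is spanning. As a ≤ uuᵀ + 1, consecutive intervals abut or overlap, so together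
-- they cover [0, a a + uuᵀ], and a a + uuᵀ is the squared norm of (a, u).
module Submission where

open import Defs
open import Data.Nat using (ℕ; zero; suc; _≤_; _<_; _+_; _*_; _∸_; _≤?_; z≤n)
open import Data.Nat.Properties
open import Data.Vec using (Vec; _∷_)
open import Data.Vec.Relation.Binary.Pointwise.Inductive using (_∷_)
open import Data.Product using (Σ; _×_; _,_)
open import Relation.Nullary using (yes; no)
open import Relation.Binary.PropositionalEquality using (_≡_; cong; trans)

next-block-start≤ : ∀ {a s m b} → a ≤ s + 1 → m + s < b → a + m ≤ b
next-block-start≤ {a} {s} {m} {b} a≤s+1 m+s<b = begin
  a + m        ≤⟨ +-monoˡ-≤ m a≤s+1 ⟩
  s + 1 + m    ≡⟨ cong (_+ m) (+-comm s 1) ⟩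
  suc (s + m)  ≡⟨ cong suc (+-comm s m) ⟩
  suc (m + s)  ≤⟨ m+s<b ⟩
  b            ∎
  where open ≤-Reasoning

spanning-multiples : ∀ {k} (u : Vec ℕ k) → Spanning u →
                     (a : ℕ) → a ≤ dot u u + 1 →
                     (c b : ℕ) → b ≤ c * a + dot u u →
                     Σ ℕ λ d → d ≤ c × Σ (Vec ℕ k) λ v → v ≤ᵥ u × d * a + dot v u ≡ b
spanning-multiples u span a a≤ zero b b≤ with span b b≤
... | v , v≤u , vu≡b = 0 , z≤n , v , v≤u , vu≡b
spanning-multiples u span a a≤ (suc c) b b≤ with b ≤? c * a + dot u u
... | yes b≤′ with spanning-multiples u span a a≤ c b b≤′
...   | d , d≤c , v , v≤u , e = d , m≤n⇒m≤1+n d≤c , v , v≤u , e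
spanning-multiples u span a a≤ (suc c) b b≤ | no b≰′
  with span (b ∸ suc c * a) (m≤n+o⇒m∸n≤o b (suc c * a) b≤)
... | v , v≤u , vu≡b∸ca =
  suc c , ≤-refl , v , v≤u ,
  trans (cong (suc c * a +_) vu≡b∸ca) (m+[n∸m]≡n (next-block-start≤ a≤ (≰⇒> b≰′)))

lemma2 : (k : ℕ) → 1 ≤ k → (u : Vec ℕ k) → Spanning u →
         (a : ℕ) → a ≤ dot u u + 1 → Spanning (a ∷ u)
lemma2 k _ u span a a≤ b b≤ with spanning-multiples u span a a≤ a b b≤
... | d , d≤a , v , v≤u , e = d ∷ v , d≤a ∷ v≤u , e
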